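{- Let $(P,\leq,{}',0,1)$ be a bounded poset (least element $0$, greatest element $1$) with a unary operation ${}'$ such that $1'=0$ and, for all $x,y\in P$, $L(x)\subseteq L(U(L(U(x,y'),y),y'))$ and $L(U(L(x,y),y'),y)\subseteq L(x)$. Define $M,R:P^2\to 2^P$ by $M(x,y)=L(U(x,y'),y)$ and $R(x,y)=L(U(L(y,x),x'))$. Then $(P,\leq,{}',M,R,0,1)$ is an operator left residuated poset.
   Context: For a poset $(P,\leq)$ and $A\subseteq P$ let $L(A)=\{x\in P\mid x\leq a\text{ for all }a\in A\}$ and $U(A)=\{x\in P\mid a\leq x\text{ for all }a\in A\}$; write $L(x)=L(\{x\})$, and when several elements or subsets are listed as arguments the union of them is meant, e.g. $L(x,y)=L(\{x,y\})$, $L(U(x,y'),y)=L(U(\{x,y'\})\cup\{y\})$. An operator left residuated poset is an ordered seventuple $(P,\leq,{}',M,R,0,1)$ where $(P,\leq,0,1)$ is a bounded poset, ${}'$ a unary operation on $P$, and $M,R:P^2\to 2^P$ satisfy for all $x,y,z\in P$: (i) $M(x,1)=M(1,x)=L(x)$; (ii) $M(x,y)\subseteq L(z)$ if and only if $L(x)\subseteq R(y,z)$; (iii) $R(x,0)=L(x')$. -}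

module Defs where

open import Level using (Level; _⊔_; suc)
import Level
open import Data.Product using (_×_; _,_)
open import Data.Sum using (_⊎_)
open import Relation.Binary.Bundles using (Poset)
open import Function.Bundles using (_⇔_)

module Subsets {c ℓ₁ ℓ₂ : Level} (𝑃 : Poset c ℓ₁ ℓ₂) where
  open Poset 𝑃 public renaming (Carrier to P)

  Sub : Set (suc (c ⊔ ℓ₁ ⊔ ℓ₂))
  Sub = P → Set (c ⊔ ℓ₁ ⊔ ℓ₂)

  _⊆_ : Sub → Sub → Set (c ⊔ ℓ₁ ⊔ ℓ₂)
  A ⊆ B = ∀ x → A x → B x

  _≐_ : Sub → Sub → Set (c ⊔ ℓ₁ ⊔ ℓ₂)
  A ≐ B = (A ⊆ B) × (B ⊆ A)

  ⟦_⟧ : P → Sub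
  ⟦ a ⟧ x = Level.Lift (c ⊔ ℓ₂) (a ≈ x)

  _∪_ : Sub → Sub → Sub
  (A ∪ B) x = A x ⊎ B x

  L : Sub → Sub
  L A x = ∀ a → A a → Level.Lift (c ⊔ ℓ₁) (x ≤ a)

  U : Sub → Sub
  U A x = ∀ a → A a → Level.Lift (c ⊔ ℓ₁) (a ≤ x)

  L₁ : P → Sub
  L₁ x = L ⟦ x ⟧

  L₂ : P → P → Sub
  L₂ x y = L (⟦ x ⟧ ∪ ⟦ y ⟧)

  U₂ : P → P → Sub
  U₂ x y = U (⟦ x ⟧ ∪ ⟦ y ⟧)

  IsBottom : P → Set (c ⊔ ℓ₂)
  IsBottom b = ∀ x → b ≤ x

  IsTop : P → Set (c ⊔ ℓ₂)
  IsTop t = ∀ x → x ≤ t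

  record IsOperatorLeftResiduatedPoset
      (_′ : P → P) (M R : P → P → Sub) (𝟘 𝟙 : P) : Set (suc (c ⊔ ℓ₁ ⊔ ℓ₂)) where
    field
      bottom : IsBottom 𝟘
      top    : IsTop 𝟙
      cond-i   : ∀ x → (M x 𝟙 ≐ L₁ x) × (M 𝟙 x ≐ L₁ x)
      cond-ii  : ∀ x y z → (M x y ⊆ L₁ z) ⇔ (L₁ x ⊆ R y z)
      cond-iii : ∀ x → R x 𝟘 ≐ L₁ (x ′)

-- Conditions (i) and (iii) hold because each of the sets M(x,1), M(1,x), R(x,0) has a least
-- element (x, x and x′ respectively), so its lower cone is a principal down-set.  Condition (ii)
-- is a Galois connection: M(x,y) ⊆ L(z) means M(x,y) ⊆ L(z,y), so the first axiom pushes
-- L(x) into R(y,z); conversely x ∈ R(y,z) makes every u ∈ U(L(z,y),y′) an upper bound of x and y′,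
-- so the second axiom bounds M(x,y) by L(z).
module Submission where

open import Defs
open import Level using (Level; lift; lower)
open import Relation.Binary.Bundles using (Poset)
open import Data.Sum using (inj₁; inj₂; [_,_])
open import Data.Product using (_,_)
open import Function.Bundles using (mk⇔)

module Cones {c ℓ₁ ℓ₂ : Level} (𝑃 : Poset c ℓ₁ ℓ₂) where
  open Subsets 𝑃

  private variable
    A B C : Sub
    a u w : P

  ⊆-trans : A ⊆ B → B ⊆ C → A ⊆ C
  ⊆-trans A⊆B B⊆C x xA = B⊆C x (A⊆B x xA)

  ∪-monoˡ : A ⊆ B → (A ∪ C) ⊆ (B ∪ C)
  ∪-monoˡ A⊆B x = [ (λ xA → inj₁ (A⊆B x xA)) , inj₂ ]

  L-antitone : A ⊆ B → L B ⊆ L A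
  L-antitone A⊆B w wB a aA = wB a (A⊆B a aA)

  U-antitone : A ⊆ B → U B ⊆ U A
  U-antitone A⊆B u uB a aA = uB a (A⊆B a aA)

  L-∪-intro : L A w → L B w → L (A ∪ B) w
  L-∪-intro wA wB a = [ wA a , wB a ]

  U-∪-intro : U A u → U B u → U (A ∪ B) u
  U-∪-intro uA uB a = [ uA a , uB a ]

  ⟦⟧-refl : ⟦ a ⟧ a
  ⟦⟧-refl = lift Eq.refl

  L₁-intro : w ≤ a → L₁ a w
  L₁-intro w≤a b (lift a≈b) = lift (trans w≤a (reflexive a≈b))

  L₁-elim : L₁ a w → w ≤ a
  L₁-elim wLa = lower (wLa _ ⟦⟧-refl)

  U₁-intro : a ≤ u → U ⟦ a ⟧ u
  U₁-intro a≤u b (lift a≈b) = lift (trans (reflexive (Eq.sym a≈b)) a≤u)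

  ⊆-L-U : A ⊆ L (U A)
  ⊆-L-U a aA u uA = uA a aA

  L⇒⊆U₁ : L A a → A ⊆ U ⟦ a ⟧
  L⇒⊆U₁ aLA u uA = U₁-intro (lower (aLA u uA))

  L-least : A a → L A a → L A ≐ L₁ a
  L-least aA aLA = (λ w wLA → L₁-intro (lower (wLA _ aA)))
                 , (λ w wLa b bA → lift (trans (L₁-elim wLa) (lower (aLA b bA))))

module Residuation {c ℓ₁ ℓ₂ : Level} (𝑃 : Poset c ℓ₁ ℓ₂) (neg : Poset.Carrier 𝑃 → Poset.Carrier 𝑃) where
  open Subsets 𝑃
  open Cones 𝑃

  M : P → P → Sub
  M x y = L (U₂ x (neg y) ∪ ⟦ y ⟧)

  R : P → P → Sub
  R x y = L (U (L₂ y x ∪ ⟦ neg x ⟧))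

  M-unitʳ : ∀ {x bot top} → IsBottom bot → IsTop top → neg top ≈ bot → M x top ≐ L₁ x
  M-unitʳ {x} {bot} {top} isBot isTop neg-top≈bot = L-least (inj₁ x-upper) x-lower
    where
    x-upper : U₂ x (neg top) x
    x-upper = U-∪-intro (U₁-intro refl) (U₁-intro (trans (reflexive neg-top≈bot) (isBot x)))
    x-lower : L (U₂ x (neg top) ∪ ⟦ top ⟧) x
    x-lower = L-∪-intro (λ u uU → uU x (inj₁ ⟦⟧-refl)) (L₁-intro (isTop x))

  M-unitˡ : ∀ {x top} → IsTop top → M top x ≐ L₁ x
  M-unitˡ {x} {top} isTop = L-least (inj₂ ⟦⟧-refl) (L-∪-intro x-below-U (L₁-intro refl))
    where
    x-below-U : L (U₂ top (neg x)) x
    x-below-U u uU = lift (trans (isTop x) (lower (uU top (inj₁ ⟦⟧-refl))))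

  R-zero : ∀ {x bot} → IsBottom bot → R x bot ≐ L₁ (neg x)
  R-zero {x} {bot} isBot = L-least neg-x-upper (⊆-L-U _ (inj₂ ⟦⟧-refl))
    where
    neg-x-upper : U (L₂ bot x ∪ ⟦ neg x ⟧) (neg x)
    neg-x-upper = U-∪-intro (λ b bL → lift (trans (lower (bL bot (inj₁ ⟦⟧-refl))) (isBot (neg x))))
                            (U₁-intro refl)

  M-⊆-L₁ : ∀ {x y} → M x y ⊆ L₁ y
  M-⊆-L₁ = L-antitone (λ _ → inj₂)

  residuate : ∀ {x y z} → (∀ x y → L₁ x ⊆ L (U (M x y ∪ ⟦ neg y ⟧))) →
              M x y ⊆ L₁ z → L₁ x ⊆ R y z
  residuate {x} {y} {z} hyp M⊆Lz =
    ⊆-trans (hyp x y) (L-antitone (U-antitone (∪-monoˡ M⊆Lzy)))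
    where
    M⊆Lzy : M x y ⊆ L₂ z y
    M⊆Lzy w wM = L-∪-intro (M⊆Lz w wM) (M-⊆-L₁ w wM)

  unresiduate : ∀ {x y z} → (∀ x y → L (U (L₂ x y ∪ ⟦ neg y ⟧) ∪ ⟦ y ⟧) ⊆ L₁ x) →
                L₁ x ⊆ R y z → M x y ⊆ L₁ z
  unresiduate {x} {y} {z} hyp Lx⊆R = ⊆-trans (L-antitone (∪-monoˡ U⊆Uxy)) (hyp z y)
    where
    U⊆Uxy : U (L₂ z y ∪ ⟦ neg y ⟧) ⊆ U₂ x (neg y)
    U⊆Uxy u uU = U-∪-intro (L⇒⊆U₁ (Lx⊆R x (L₁-intro refl)) u uU)
                           (U-antitone (λ _ → inj₂) u uU)

theorem1 : ∀ {c ℓ₁ ℓ₂ : Level} (𝑃 : Poset c ℓ₁ ℓ₂) → let open Subsets 𝑃 in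
    (neg : P → P) → (bot top : P) →
    IsBottom bot → IsTop top →
    neg top ≈ bot →
    (∀ x y → L₁ x ⊆ L (U (L (U₂ x (neg y) ∪ ⟦ y ⟧) ∪ ⟦ neg y ⟧))) →
    (∀ x y → L (U (L₂ x y ∪ ⟦ neg y ⟧) ∪ ⟦ y ⟧) ⊆ L₁ x) →
    IsOperatorLeftResiduatedPoset neg
      (λ x y → L (U₂ x (neg y) ∪ ⟦ y ⟧))
      (λ x y → L (U (L₂ y x ∪ ⟦ neg x ⟧)))
      bot top
theorem1 𝑃 neg bot top isBot isTop neg-top≈bot hyp₁ hyp₂ = record
  { bottom   = isBot
  ; top      = isTop
  ; cond-i   = λ x → M-unitʳ isBot isTop neg-top≈bot , M-unitˡ isTop
  ; cond-ii  = λ x y z → mk⇔ (residuate hyp₁) (unresiduate hyp₂)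
  ; cond-iii = λ x → R-zero isBot
  }
  where open Residuation 𝑃 neg
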